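{- For all nonnegative integers $a$, $$\sum_{N=0}^{\infty}p(2N-2a,4,N)z^N=\frac{z^{a}\left(1+z^2-z^{a+1}\right)}{(1-z)^2(1-z^2)(1-z^3)},\qquad \sum_{N=0}^{\infty}p(2N-2a-1,4,N)z^N=\frac{z^{a}\left(z+z^2-z^{a+2}\right)}{(1-z)^2(1-z^2)(1-z^3)}.$$
   Context: For integers $n$ and $m,N\ge0$, $p(n,m,N)$ is the number of partitions of $n$ into at most $m$ parts, each part at most $N$; equivalently the coefficient of $q^n$ in the Gaussian polynomial $\begin{bmatrix}N+m\\ m\end{bmatrix}_q=\frac{(q;q)_{N+m}}{(q;q)_m(q;q)_N}$, where $(q;q)_k=(1-q)\cdots(1-q^k)$. In particular $p(n,m,N)=0$ for $n<0$. -}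

module Defs where

open import Data.Nat as ℕ using (ℕ; zero; suc; _∸_)
open import Data.Nat.Divisibility using (_∣?_)
open import Data.Integer as ℤ using (ℤ; +_; -[1+_]; 0ℤ; 1ℤ)
open import Data.Bool using (if_then_else_)
open import Relation.Nullary.Decidable using (⌊_⌋)

-- cnt m b n = number of sequences b ≥ λ₁ ≥ λ₂ ≥ … ≥ λₘ ≥ 0 with
-- λ₁ + … + λₘ = n, i.e. partitions of n into at most m parts,
-- each part at most b (λ₁ is chosen as k ≤ b, the rest are ≤ k).
cntUpTo : (ℕ → ℕ) → ℕ → ℕ
cntUpTo f zero    = f zero
cntUpTo f (suc b) = cntUpTo f b ℕ.+ f (suc b)

cnt : ℕ → ℕ → ℕ → ℕ
cnt zero    b zero    = 1
cnt zero    b (suc n) = 0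
cnt (suc m) b n       = cntUpTo (λ k → cnt m k (n ∸ k) ℕ.* (if ⌊ k ℕ.≤? n ⌋ then 1 else 0)) b

p : ℤ → ℕ → ℕ → ℕ
p (+ n)    m N = cnt m N n
p -[1+ n ] m N = 0

Series : Set
Series = ℕ → ℤ

sumTo : (ℕ → ℤ) → ℕ → ℤ
sumTo f zero    = f zero
sumTo f (suc n) = sumTo f n ℤ.+ f (suc n)

_⊕_ : Series → Series → Series
(f ⊕ g) n = f n ℤ.+ g n

_⊖_ : Series → Series → Series
(f ⊖ g) n = f n ℤ.- g n

_⊛_ : Series → Series → Series
(f ⊛ g) n = sumTo (λ i → f i ℤ.* g (n ∸ i)) n

infixl 6 _⊕_ _⊖_
infixl 7 _⊛_

zpow : ℕ → Series
zpow k n = if ⌊ n ℕ.≟ k ⌋ then 1ℤ else 0ℤ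

-- 1 / (1 - z^k) = Σ_j z^{kj}   (for k ≥ 1)
inv1-zpow : ℕ → Series
inv1-zpow k n = if ⌊ k ∣? n ⌋ then 1ℤ else 0ℤ

invDen : Series
invDen = inv1-zpow 1 ⊛ inv1-zpow 1 ⊛ inv1-zpow 2 ⊛ inv1-zpow 3

lhsEven : ℕ → Series
lhsEven a N = + p (+ (2 ℕ.* N) ℤ.- + (2 ℕ.* a)) 4 N

lhsOdd : ℕ → Series
lhsOdd a N = + p (+ (2 ℕ.* N) ℤ.- + (2 ℕ.* a) ℤ.- 1ℤ) 4 N

rhsEven : ℕ → Series
rhsEven a = zpow a ⊛ (zpow 0 ⊕ zpow 2 ⊖ zpow (suc a)) ⊛ invDen

rhsOdd : ℕ → Series
rhsOdd a = zpow a ⊛ (zpow 1 ⊕ zpow 2 ⊖ zpow (a ℕ.+ 2)) ⊛ invDen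

-- Let Pₘ = Σₙ p(n, m, ∞) zⁿ; removing one from each part of a partition with exactly m parts
-- gives (1 - zᵐ) Pₘ = Pₘ₋₁.  A partition of n ≤ 2N + 2 into at most four parts whose largest part
-- N + 1 + j exceeds N leaves n - N - 1 - j ≤ N + 1 + j for the other three, so their bound is void:
-- p(n, 4, N) is the coefficient of zⁿ in P₄ - z^(N+1) P₃ / (1 - z), and P₃ / (1 - z) = 1 / D with
-- D = (1 - z)² (1 - z²) (1 - z³).  At n = 2N - 2a (resp. 2N - 2a - 1) only the even (resp. odd)
-- part of P₄ enters.  Splitting P₄ = P₃ / (1 - z⁴) and P₃ = P₂ / (1 - z³) into even and odd parts,
-- where both parts of P₂ equal 1 / (1 - z)², the even and odd parts of P₄ are (1 + z²) / D and
-- (1 + z) / D.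

module Submission where

open import Data.Bool using (if_then_else_)
open import Data.Integer using (ℤ; +_; -_; 0ℤ; 1ℤ; _+_; _-_; _*_)
import Data.Integer.Properties as ℤₚ
open import Data.Integer.Tactic.RingSolver using (solve-∀)
open import Data.Nat as ℕ using (ℕ; zero; suc; _∸_; _≤_; _<_; z≤n; s≤s)
open import Data.Nat.Divisibility using (_∣?_; _∣0; n∣n; ∣m+n∣m⇒∣n; ∣m∣n⇒∣m+n; ∣⇒≤; 1∣_)
open import Data.Nat.Induction using (<-rec)
import Data.Nat.Properties as ℕₚ
import Data.Nat.Tactic.RingSolver as ℕ-Solver
open import Data.Product using (_×_; _,_)
open import Data.Sum using (inj₁; inj₂)
open import Function using (_∘_)
open import Relation.Binary.PropositionalEquality
open import Relation.Nullary using (Dec; yes; no; contradiction)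
open import Relation.Nullary.Decidable using (⌊_⌋)
open ≡-Reasoning

open import Defs

-- Shifts and the operators Δ c = 1 - z^c

infixr 8 z^_·_

z^_·_ : ℕ → Series → Series
(z^ zero  · f) n       = f n
(z^ suc k · f) zero    = 0ℤ
(z^ suc k · f) (suc n) = (z^ k · f) n

shift-cong : ∀ k {f g} → f ≗ g → z^ k · f ≗ z^ k · g
shift-cong zero    f≗g n       = f≗g n
shift-cong (suc k) f≗g zero    = refl
shift-cong (suc k) f≗g (suc n) = shift-cong k f≗g n

shift-cong-≤ : ∀ k {f g} n → (∀ x → k ℕ.+ x ≤ n → f x ≡ g x) → (z^ k · f) n ≡ (z^ k · g) n
shift-cong-≤ zero    n       eq = eq n ℕₚ.≤-refl
shift-cong-≤ (suc k) zero    eq = refl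
shift-cong-≤ (suc k) (suc n) eq = shift-cong-≤ k n (λ x k+x≤n → eq x (s≤s k+x≤n))

shift-+ : ∀ k (f : Series) x → (z^ k · f) (k ℕ.+ x) ≡ f x
shift-+ zero    f x = refl
shift-+ (suc k) f x = shift-+ k f x

shift-< : ∀ k (f : Series) {n} → n < k → (z^ k · f) n ≡ 0ℤ
shift-< (suc k) f {zero}  _         = refl
shift-< (suc k) f {suc n} (s≤s n<k) = shift-< k f n<k

shift-shift : ∀ j k (f : Series) → z^ j · z^ k · f ≗ z^ (j ℕ.+ k) · f
shift-shift zero    k f n       = refl
shift-shift (suc j) k f zero    = refl
shift-shift (suc j) k f (suc n) = shift-shift j k f n

shift-reindex : ∀ (f : Series) {k k′ i i′} → k ≡ k′ → i ≡ i′ → (z^ k · f) i ≡ (z^ k′ · f) i′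
shift-reindex f = cong₂ (λ k i → (z^ k · f) i)

shift-offset : ∀ j k (f : Series) x → (z^ (j ℕ.+ k) · f) (j ℕ.+ x) ≡ (z^ k · f) x
shift-offset j k f x = trans (sym (shift-shift j k f (j ℕ.+ x))) (shift-+ j (z^ k · f) x)

shift-comm : ∀ j k (f : Series) → z^ j · z^ k · f ≗ z^ k · z^ j · f
shift-comm j k f n = begin
  (z^ j · z^ k · f) n   ≡⟨ shift-shift j k f n ⟩
  (z^ (j ℕ.+ k) · f) n  ≡⟨ cong (λ i → (z^ i · f) n) (ℕₚ.+-comm j k) ⟩
  (z^ (k ℕ.+ j) · f) n  ≡⟨ shift-shift k j f n ⟨
  (z^ k · z^ j · f) n   ∎

shift-⊕ : ∀ k (f g : Series) → z^ k · (f ⊕ g) ≗ z^ k · f ⊕ z^ k · g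
shift-⊕ zero    f g n       = refl
shift-⊕ (suc k) f g zero    = refl
shift-⊕ (suc k) f g (suc n) = shift-⊕ k f g n

shift-⊖ : ∀ k (f g : Series) → z^ k · (f ⊖ g) ≗ z^ k · f ⊖ z^ k · g
shift-⊖ zero    f g n       = refl
shift-⊖ (suc k) f g zero    = refl
shift-⊖ (suc k) f g (suc n) = shift-⊖ k f g n

Δ : ℕ → Series → Series
Δ c h = h ⊖ z^ c · h

Δ-cong : ∀ c {f g} → f ≗ g → Δ c f ≗ Δ c g
Δ-cong c f≗g n = cong₂ _-_ (f≗g n) (shift-cong c f≗g n)

unfold⇒Δ : ∀ c f h → h ≗ f ⊕ z^ c · h → Δ c h ≗ f
unfold⇒Δ c f h h≗ n = begin
  h n - (z^ c · h) n                       ≡⟨ cong (_- (z^ c · h) n) (h≗ n) ⟩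
  f n + (z^ c · h) n - (z^ c · h) n        ≡⟨ cancel (f n) _ ⟩
  f n                                      ∎
  where
  cancel : ∀ a b → a + b - b ≡ a
  cancel = solve-∀

Δ-injective : ∀ c {f g} → Δ (suc c) f ≗ Δ (suc c) g → f ≗ g
Δ-injective c {f} {g} Δf≗Δg = <-rec (λ n → f n ≡ g n) step
  where
  split : ∀ a b → a ≡ (a - b) + b
  split = solve-∀
  step : ∀ n → (∀ {x} → x < n → f x ≡ g x) → f n ≡ g n
  step n ih = begin
    f n                                              ≡⟨ split (f n) _ ⟩
    Δ (suc c) f n + (z^ suc c · f) n                 ≡⟨ cong₂ _+_ (Δf≗Δg n) earlier ⟩
    Δ (suc c) g n + (z^ suc c · g) n                 ≡⟨ split (g n) _ ⟨
    g n                                              ∎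
    where
    earlier : (z^ suc c · f) n ≡ (z^ suc c · g) n
    earlier = shift-cong-≤ (suc c) n (λ x 1+c+x≤n → ih (ℕₚ.<-≤-trans (s≤s (ℕₚ.m≤n+m x c)) 1+c+x≤n))

Δ-⊕ : ∀ c (f g : Series) → Δ c (f ⊕ g) ≗ Δ c f ⊕ Δ c g
Δ-⊕ c f g n = begin
  f n + g n - (z^ c · (f ⊕ g)) n                       ≡⟨ cong (_-_ (f n + g n)) (shift-⊕ c f g n) ⟩
  f n + g n - ((z^ c · f) n + (z^ c · g) n)            ≡⟨ interchange (f n) (g n) _ _ ⟩
  (f n - (z^ c · f) n) + (g n - (z^ c · g) n)          ∎
  where
  interchange : ∀ a b c d → a + b - (c + d) ≡ (a - c) + (b - d)
  interchange = solve-∀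

Δ-shift : ∀ c k (f : Series) → Δ c (z^ k · f) ≗ z^ k · Δ c f
Δ-shift c k f n = begin
  (z^ k · f) n - (z^ c · z^ k · f) n   ≡⟨ cong (_-_ ((z^ k · f) n)) (shift-comm c k f n) ⟩
  (z^ k · f) n - (z^ k · z^ c · f) n   ≡⟨ shift-⊖ k f (z^ c · f) n ⟨
  (z^ k · Δ c f) n                     ∎

Δ-comm : ∀ c k (f : Series) → Δ c (Δ k f) ≗ Δ k (Δ c f)
Δ-comm c k f n = begin
  Δ k f n - (z^ c · Δ k f) n                                   ≡⟨ cong (_-_ (Δ k f n)) (shift-⊖ c f (z^ k · f) n) ⟩
  f n - (z^ k · f) n - ((z^ c · f) n - (z^ c · z^ k · f) n)    ≡⟨ cong (λ t → f n - (z^ k · f) n - ((z^ c · f) n - t)) (shift-comm c k f n) ⟩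
  f n - (z^ k · f) n - ((z^ c · f) n - (z^ k · z^ c · f) n)    ≡⟨ swap (f n) _ _ _ ⟩
  f n - (z^ c · f) n - ((z^ k · f) n - (z^ k · z^ c · f) n)    ≡⟨ cong (_-_ (Δ c f n)) (shift-⊖ k f (z^ c · f) n) ⟨
  Δ c f n - (z^ k · Δ c f) n                                   ∎
  where
  swap : ∀ a b c d → a - b - (c - d) ≡ a - c - (b - d)
  swap = solve-∀

Δ-shifted-sum : ∀ c k {f} h → Δ c h ≗ f → Δ c (h ⊕ z^ k · h) ≗ f ⊕ z^ k · f
Δ-shifted-sum c k {f} h Δh≗f n = begin
  Δ c (h ⊕ z^ k · h) n             ≡⟨ Δ-⊕ c h (z^ k · h) n ⟩
  Δ c h n + Δ c (z^ k · h) n       ≡⟨ cong (_+_ (Δ c h n)) (Δ-shift c k h n) ⟩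
  Δ c h n + (z^ k · Δ c h) n       ≡⟨ cong₂ _+_ (Δh≗f n) (shift-cong k Δh≗f n) ⟩
  f n + (z^ k · f) n               ∎

Δ-coupled : ∀ a b {u v x y} → u ⊖ z^ a · v ≗ x → v ⊖ z^ b · u ≗ y → Δ (a ℕ.+ b) u ≗ x ⊕ z^ a · y
Δ-coupled a b {u} {v} {x} {y} eqᵤ eqᵥ n = begin
  u n - (z^ (a ℕ.+ b) · u) n                                  ≡⟨ ℤₚ.+-minus-telescope (u n) ((z^ a · v) n) _ ⟨
  (u n - (z^ a · v) n) + ((z^ a · v) n - (z^ (a ℕ.+ b) · u) n) ≡⟨ cong₂ (λ s t → s + ((z^ a · v) n - t)) (eqᵤ n) (sym (shift-shift a b u n)) ⟩
  x n + ((z^ a · v) n - (z^ a · z^ b · u) n)                  ≡⟨ cong (_+_ (x n)) (shift-⊖ a v (z^ b · u) n) ⟨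
  x n + (z^ a · (v ⊖ z^ b · u)) n                             ≡⟨ cong (_+_ (x n)) (shift-cong a eqᵥ n) ⟩
  x n + (z^ a · y) n                                          ∎

sumTo-cong : ∀ {F G : ℕ → ℤ} n → (∀ i → i ≤ n → F i ≡ G i) → sumTo F n ≡ sumTo G n
sumTo-cong zero    F≡G = F≡G 0 z≤n
sumTo-cong (suc n) F≡G = cong₂ _+_ (sumTo-cong n (λ i i≤n → F≡G i (ℕₚ.m≤n⇒m≤1+n i≤n))) (F≡G (suc n) ℕₚ.≤-refl)

sumTo-zero : ∀ {F : ℕ → ℤ} n → (∀ i → i ≤ n → F i ≡ 0ℤ) → sumTo F n ≡ 0ℤ
sumTo-zero zero    F≡0 = F≡0 0 z≤n
sumTo-zero (suc n) F≡0 = cong₂ _+_ (sumTo-zero n (λ i i≤n → F≡0 i (ℕₚ.m≤n⇒m≤1+n i≤n))) (F≡0 (suc n) ℕₚ.≤-refl)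

sumTo-⊕ : ∀ (F G : ℕ → ℤ) n → sumTo (F ⊕ G) n ≡ sumTo F n + sumTo G n
sumTo-⊕ F G zero    = refl
sumTo-⊕ F G (suc n) =
  trans (cong (_+ (F (suc n) + G (suc n))) (sumTo-⊕ F G n)) (interchange (sumTo F n) (sumTo G n) (F (suc n)) (G (suc n)))
  where
  interchange : ∀ a b c d → (a + b) + (c + d) ≡ (a + c) + (b + d)
  interchange = solve-∀

sumTo-⊖ : ∀ (F G : ℕ → ℤ) n → sumTo (F ⊖ G) n ≡ sumTo F n - sumTo G n
sumTo-⊖ F G zero    = refl
sumTo-⊖ F G (suc n) =
  trans (cong (_+ (F (suc n) - G (suc n))) (sumTo-⊖ F G n)) (interchange (sumTo F n) (sumTo G n) (F (suc n)) (G (suc n)))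
  where
  interchange : ∀ a b c d → (a - b) + (c - d) ≡ (a + c) - (b + d)
  interchange = solve-∀

sumTo-suc : ∀ (F : ℕ → ℤ) n → sumTo F (suc n) ≡ F 0 + sumTo (F ∘ suc) n
sumTo-suc F zero    = refl
sumTo-suc F (suc n) = trans (cong (_+ F (suc (suc n))) (sumTo-suc F n)) (ℤₚ.+-assoc (F 0) _ _)

⊛-congˡ : ∀ {f f′} g → f ≗ f′ → f ⊛ g ≗ f′ ⊛ g
⊛-congˡ g f≗f′ n = sumTo-cong n (λ i _ → cong (_* g (n ∸ i)) (f≗f′ i))

⊛-congʳ : ∀ f {g g′} → g ≗ g′ → f ⊛ g ≗ f ⊛ g′
⊛-congʳ f g≗g′ n = sumTo-cong n (λ i _ → cong (f i *_) (g≗g′ (n ∸ i)))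

⊛-distribˡ-⊕ : ∀ f g g′ → f ⊛ (g ⊕ g′) ≗ f ⊛ g ⊕ f ⊛ g′
⊛-distribˡ-⊕ f g g′ n =
  trans (sumTo-cong n (λ i _ → ℤₚ.*-distribˡ-+ (f i) (g (n ∸ i)) (g′ (n ∸ i)))) (sumTo-⊕ _ _ n)

⊛-distribʳ-⊕ : ∀ f f′ g → (f ⊕ f′) ⊛ g ≗ f ⊛ g ⊕ f′ ⊛ g
⊛-distribʳ-⊕ f f′ g n =
  trans (sumTo-cong n (λ i _ → ℤₚ.*-distribʳ-+ (g (n ∸ i)) (f i) (f′ i))) (sumTo-⊕ _ _ n)

⊛-distribʳ-⊖ : ∀ f f′ g → (f ⊖ f′) ⊛ g ≗ f ⊛ g ⊖ f′ ⊛ g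
⊛-distribʳ-⊖ f f′ g n =
  trans (sumTo-cong n (λ i _ → distrib (f i) (f′ i) (g (n ∸ i)))) (sumTo-⊖ _ _ n)
  where
  distrib : ∀ a b c → (a - b) * c ≡ a * c - b * c
  distrib = solve-∀

δ : Series
δ zero    = 1ℤ
δ (suc n) = 0ℤ

⊛-identityˡ : ∀ g → δ ⊛ g ≗ g
⊛-identityˡ g zero    = ℤₚ.*-identityˡ (g 0)
⊛-identityˡ g (suc n) = begin
  (δ ⊛ g) (suc n)                              ≡⟨ sumTo-suc _ n ⟩
  1ℤ * g (suc n) + sumTo (λ _ → 0ℤ) n          ≡⟨ cong₂ _+_ (ℤₚ.*-identityˡ (g (suc n))) (sumTo-zero n (λ _ _ → refl)) ⟩
  g (suc n) + 0ℤ                               ≡⟨ ℤₚ.+-identityʳ (g (suc n)) ⟩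
  g (suc n)                                    ∎

⊛-identityʳ : ∀ f → f ⊛ δ ≗ f
⊛-identityʳ f zero    = ℤₚ.*-identityʳ (f 0)
⊛-identityʳ f (suc n) = begin
  (f ⊛ δ) (suc n)                                                  ≡⟨⟩
  sumTo (λ i → f i * δ (suc n ∸ i)) n + f (suc n) * δ (n ∸ n)      ≡⟨ cong₂ _+_ earlier (cong (λ j → f (suc n) * δ j) (ℕₚ.n∸n≡0 n)) ⟩
  0ℤ + f (suc n) * 1ℤ                                              ≡⟨ trans (ℤₚ.+-identityˡ _) (ℤₚ.*-identityʳ (f (suc n))) ⟩
  f (suc n)                                                        ∎
  where
  earlier : sumTo (λ i → f i * δ (suc n ∸ i)) n ≡ 0ℤ
  earlier = sumTo-zero n (λ i i≤n →
    trans (cong (λ j → f i * δ j) (ℕₚ.+-∸-assoc 1 i≤n)) (ℤₚ.*-zeroʳ (f i)))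

⊛-shift₁ˡ : ∀ f g → (z^ 1 · f) ⊛ g ≗ z^ 1 · (f ⊛ g)
⊛-shift₁ˡ f g zero    = refl
⊛-shift₁ˡ f g (suc n) = trans (sumTo-suc _ n) (ℤₚ.+-identityˡ _)

⊛-shift₁ʳ : ∀ f g → f ⊛ z^ 1 · g ≗ z^ 1 · (f ⊛ g)
⊛-shift₁ʳ f g zero    = ℤₚ.*-zeroʳ (f 0)
⊛-shift₁ʳ f g (suc n) = begin
  sumTo (λ i → f i * (z^ 1 · g) (suc n ∸ i)) n + f (suc n) * (z^ 1 · g) (n ∸ n)
    ≡⟨ cong₂ _+_ earlier (trans (cong (λ j → f (suc n) * (z^ 1 · g) j) (ℕₚ.n∸n≡0 n)) (ℤₚ.*-zeroʳ (f (suc n)))) ⟩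
  (f ⊛ g) n + 0ℤ
    ≡⟨ ℤₚ.+-identityʳ _ ⟩
  (f ⊛ g) n ∎
  where
  earlier : sumTo (λ i → f i * (z^ 1 · g) (suc n ∸ i)) n ≡ (f ⊛ g) n
  earlier = sumTo-cong n (λ i i≤n → cong (λ j → f i * (z^ 1 · g) j) (ℕₚ.+-∸-assoc 1 i≤n))

⊛-shiftˡ : ∀ k f g → (z^ k · f) ⊛ g ≗ z^ k · (f ⊛ g)
⊛-shiftˡ zero    f g n = refl
⊛-shiftˡ (suc k) f g n = begin
  ((z^ suc k · f) ⊛ g) n          ≡⟨ ⊛-congˡ g (sym ∘ shift-shift 1 k f) n ⟩
  ((z^ 1 · z^ k · f) ⊛ g) n       ≡⟨ ⊛-shift₁ˡ (z^ k · f) g n ⟩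
  (z^ 1 · ((z^ k · f) ⊛ g)) n     ≡⟨ shift-cong 1 (⊛-shiftˡ k f g) n ⟩
  (z^ 1 · z^ k · (f ⊛ g)) n       ≡⟨ shift-shift 1 k (f ⊛ g) n ⟩
  (z^ suc k · (f ⊛ g)) n          ∎

⊛-shiftʳ : ∀ k f g → f ⊛ z^ k · g ≗ z^ k · (f ⊛ g)
⊛-shiftʳ zero    f g n = refl
⊛-shiftʳ (suc k) f g n = begin
  (f ⊛ z^ suc k · g) n            ≡⟨ ⊛-congʳ f (sym ∘ shift-shift 1 k g) n ⟩
  (f ⊛ z^ 1 · z^ k · g) n         ≡⟨ ⊛-shift₁ʳ f (z^ k · g) n ⟩
  (z^ 1 · (f ⊛ z^ k · g)) n       ≡⟨ shift-cong 1 (⊛-shiftʳ k f g) n ⟩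
  (z^ 1 · z^ k · (f ⊛ g)) n       ≡⟨ shift-shift 1 k (f ⊛ g) n ⟩
  (z^ suc k · (f ⊛ g)) n          ∎

zpow-diag : ∀ k → zpow k k ≡ 1ℤ
zpow-diag k with k ℕ.≟ k
... | yes _   = refl
... | no k≢k  = contradiction refl k≢k

zpow-off-diag : ∀ {k n} → n ≢ k → zpow k n ≡ 0ℤ
zpow-off-diag {k} {n} n≢k with n ℕ.≟ k
... | yes n≡k = contradiction n≡k n≢k
... | no _    = refl

zpow-suc : ∀ k n → zpow (suc k) (suc n) ≡ zpow k n
zpow-suc k n = by-cases (n ℕ.≟ k)
  where
  by-cases : Dec (n ≡ k) → zpow (suc k) (suc n) ≡ zpow k n
  by-cases (yes refl) = trans (zpow-diag (suc n)) (sym (zpow-diag n))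
  by-cases (no n≢k)   = trans (zpow-off-diag (n≢k ∘ ℕₚ.suc-injective)) (sym (zpow-off-diag n≢k))

zpow-δ : ∀ k → zpow k ≗ z^ k · δ
zpow-δ zero    zero    = refl
zpow-δ zero    (suc n) = refl
zpow-δ (suc k) zero    = refl
zpow-δ (suc k) (suc n) = trans (zpow-suc k n) (zpow-δ k n)

zpow-⊛ : ∀ k g → zpow k ⊛ g ≗ z^ k · g
zpow-⊛ k g n = begin
  (zpow k ⊛ g) n         ≡⟨ ⊛-congˡ g (zpow-δ k) n ⟩
  ((z^ k · δ) ⊛ g) n     ≡⟨ ⊛-shiftˡ k δ g n ⟩
  (z^ k · (δ ⊛ g)) n     ≡⟨ shift-cong k (⊛-identityˡ g) n ⟩
  (z^ k · g) n           ∎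

inv1-zpow-zero : ∀ c → inv1-zpow (suc c) 0 ≡ 1ℤ
inv1-zpow-zero c with suc c ∣? 0
... | yes _    = refl
... | no 1+c∤0 = contradiction (suc c ∣0) 1+c∤0

inv1-zpow-< : ∀ c {n} → n < c → inv1-zpow (suc c) (suc n) ≡ 0ℤ
inv1-zpow-< c {n} n<c with suc c ∣? suc n
... | yes 1+c∣1+n = contradiction (∣⇒≤ 1+c∣1+n) (ℕₚ.<⇒≱ (s≤s n<c))
... | no _        = refl

inv1-zpow-periodic : ∀ c m → inv1-zpow (suc c) (suc c ℕ.+ m) ≡ inv1-zpow (suc c) m
inv1-zpow-periodic c m with suc c ∣? suc c ℕ.+ m | suc c ∣? m
... | yes _     | yes _   = refl
... | no _      | no _    = refl
... | yes 1+c∣n | no 1+c∤m = contradiction (∣m+n∣m⇒∣n 1+c∣n n∣n) 1+c∤m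
... | no 1+c∤n  | yes 1+c∣m = contradiction (∣m∣n⇒∣m+n n∣n 1+c∣m) 1+c∤n

inv1-zpow-one : ∀ n → inv1-zpow 1 n ≡ 1ℤ
inv1-zpow-one n with 1 ∣? n
... | yes _  = refl
... | no 1∤n = contradiction (1∣ n) 1∤n

inv1-zpow-unfold : ∀ c → inv1-zpow (suc c) ≗ δ ⊕ z^ suc c · inv1-zpow (suc c)
inv1-zpow-unfold c n with suc c ℕ.≤? n
... | yes 1+c≤n with ℕₚ.m≤n⇒∃[o]m+o≡n 1+c≤n
...   | m , refl = begin
  inv1-zpow (suc c) (suc c ℕ.+ m)                              ≡⟨ inv1-zpow-periodic c m ⟩
  inv1-zpow (suc c) m                                          ≡⟨ shift-+ (suc c) (inv1-zpow (suc c)) m ⟨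
  (z^ suc c · inv1-zpow (suc c)) (suc c ℕ.+ m)                 ≡⟨ ℤₚ.+-identityˡ _ ⟨
  0ℤ + (z^ suc c · inv1-zpow (suc c)) (suc c ℕ.+ m)            ∎
inv1-zpow-unfold c zero    | no _ = inv1-zpow-zero c
inv1-zpow-unfold c (suc n) | no 1+c≰1+n = begin
  inv1-zpow (suc c) (suc n)                         ≡⟨ inv1-zpow-< c n<c ⟩
  0ℤ                                                ≡⟨ cong (_+_ 0ℤ) (shift-< (suc c) _ (s≤s n<c)) ⟨
  0ℤ + (z^ suc c · inv1-zpow (suc c)) (suc n)       ∎
  where
  n<c : n < c
  n<c = ℕₚ.≤-pred (ℕₚ.≰⇒> 1+c≰1+n)

Δ-⊛-inv1-zpow : ∀ c f → Δ (suc c) (f ⊛ inv1-zpow (suc c)) ≗ f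
Δ-⊛-inv1-zpow c f = unfold⇒Δ (suc c) f (f ⊛ I) λ n → begin
  (f ⊛ I) n                                 ≡⟨ ⊛-congʳ f (inv1-zpow-unfold c) n ⟩
  (f ⊛ (δ ⊕ z^ suc c · I)) n                ≡⟨ ⊛-distribˡ-⊕ f δ (z^ suc c · I) n ⟩
  (f ⊛ δ) n + (f ⊛ z^ suc c · I) n          ≡⟨ cong₂ _+_ (⊛-identityʳ f n) (⊛-shiftʳ (suc c) f I n) ⟩
  f n + (z^ suc c · (f ⊛ I)) n              ∎
  where
  I = inv1-zpow (suc c)

monomial-⊛ : ∀ a b c d g →
  zpow a ⊛ (zpow b ⊕ zpow c ⊖ zpow d) ⊛ g ≗ z^ a · (z^ b · g ⊕ z^ c · g ⊖ z^ d · g)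
monomial-⊛ a b c d g n = begin
  (zpow a ⊛ X ⊛ g) n        ≡⟨ ⊛-congˡ g (zpow-⊛ a X) n ⟩
  ((z^ a · X) ⊛ g) n        ≡⟨ ⊛-shiftˡ a X g n ⟩
  (z^ a · (X ⊛ g)) n        ≡⟨ shift-cong a expand n ⟩
  (z^ a · (z^ b · g ⊕ z^ c · g ⊖ z^ d · g)) n ∎
  where
  X = zpow b ⊕ zpow c ⊖ zpow d
  expand : X ⊛ g ≗ z^ b · g ⊕ z^ c · g ⊖ z^ d · g
  expand m = begin
    (X ⊛ g) m                                                  ≡⟨ ⊛-distribʳ-⊖ (zpow b ⊕ zpow c) (zpow d) g m ⟩
    ((zpow b ⊕ zpow c) ⊛ g) m - (zpow d ⊛ g) m                 ≡⟨ cong (_- (zpow d ⊛ g) m) (⊛-distribʳ-⊕ (zpow b) (zpow c) g m) ⟩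
    (zpow b ⊛ g) m + (zpow c ⊛ g) m - (zpow d ⊛ g) m           ≡⟨ cong₂ _-_ (cong₂ _+_ (zpow-⊛ b g m) (zpow-⊛ c g m)) (zpow-⊛ d g m) ⟩
    (z^ b · g) m + (z^ c · g) m - (z^ d · g) m                 ∎

-- Gaussian coefficients and partitions

-- gauss m b n = p(n, m, b), the coefficients of the Gaussian polynomial [m + b, m] in z.
gauss : ℕ → ℕ → Series
gauss m b n = + cnt m b n

indicator-shift : ∀ (g : ℕ → ℕ) k n →
  + (g (n ∸ k) ℕ.* (if ⌊ k ℕ.≤? n ⌋ then 1 else 0)) ≡ (z^ k · (+_ ∘ g)) n
indicator-shift g k n with k ℕ.≤? n
... | no k≰n = trans (cong +_ (ℕₚ.*-zeroʳ (g (n ∸ k)))) (sym (shift-< k (+_ ∘ g) (ℕₚ.≰⇒> k≰n)))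
... | yes k≤n with ℕₚ.m≤n⇒∃[o]m+o≡n k≤n
...   | m , refl = begin
  + (g (k ℕ.+ m ∸ k) ℕ.* 1)   ≡⟨ cong (λ i → + (g i ℕ.* 1)) (ℕₚ.m+n∸m≡n k m) ⟩
  + (g m ℕ.* 1)               ≡⟨ cong +_ (ℕₚ.*-identityʳ (g m)) ⟩
  + g m                       ≡⟨ shift-+ k (+_ ∘ g) m ⟨
  (z^ k · (+_ ∘ g)) (k ℕ.+ m) ∎

gauss-pascal₁ : ∀ m b → gauss (suc m) (suc b) ≗ gauss (suc m) b ⊕ z^ suc b · gauss m (suc b)
gauss-pascal₁ m b n =
  trans (ℤₚ.pos-+ (cnt (suc m) b n) _) (cong (_+_ (gauss (suc m) b n)) (indicator-shift (cnt m (suc b)) (suc b) n))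

gauss-zero-parts : ∀ b → gauss 0 b ≗ δ
gauss-zero-parts b zero    = refl
gauss-zero-parts b (suc n) = refl

gauss-zero-bound : ∀ m → gauss m 0 ≗ δ
gauss-zero-bound zero    = gauss-zero-parts 0
gauss-zero-bound (suc m) n = trans (indicator-shift (cnt m 0) 0 n) (gauss-zero-bound m n)

gauss-raise-bound : ∀ m {b j} → j ≤ b → gauss m (suc b) j ≡ gauss m b j
gauss-raise-bound zero    {b} {j} _   = trans (gauss-zero-parts (suc b) j) (sym (gauss-zero-parts b j))
gauss-raise-bound (suc m) {b} {j} j≤b = begin
  gauss (suc m) (suc b) j                                  ≡⟨ gauss-pascal₁ m b j ⟩
  gauss (suc m) b j + (z^ suc b · gauss m (suc b)) j       ≡⟨ cong (_+_ (gauss (suc m) b j)) (shift-< (suc b) _ (s≤s j≤b)) ⟩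
  gauss (suc m) b j + 0ℤ                                   ≡⟨ ℤₚ.+-identityʳ _ ⟩
  gauss (suc m) b j                                        ∎

gauss-stable : ∀ m {j} b → j ≤ b → gauss m b j ≡ gauss m j j
gauss-stable m zero    z≤n = refl
gauss-stable m (suc b) j≤1+b with ℕₚ.m≤n⇒m<n∨m≡n j≤1+b
... | inj₁ (s≤s j≤b) = trans (gauss-raise-bound m j≤b) (gauss-stable m b j≤b)
... | inj₂ refl      = refl

gauss-zero-parts-bound : ∀ m b → gauss m 0 ≗ gauss 0 b
gauss-zero-parts-bound m b n = trans (gauss-zero-bound m n) (sym (gauss-zero-parts b n))

gauss-zero-parts-same : ∀ b b′ → gauss 0 b ≗ gauss 0 b′
gauss-zero-parts-same b b′ n = trans (gauss-zero-parts b n) (sym (gauss-zero-parts b′ n))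

mutual
  gauss-pascal₂ : ∀ m b → gauss (suc m) (suc b) ≗ gauss m (suc b) ⊕ z^ suc m · gauss (suc m) b
  gauss-pascal₂ zero zero n =
    trans (gauss-pascal₁ 0 0 n) (cong₂ _+_ (gauss-zero-parts-bound 1 1 n) (shift-cong 1 (sym ∘ gauss-zero-parts-bound 1 1) n))
  gauss-pascal₂ zero (suc b) n = begin
    gauss 1 (2 ℕ.+ b) n                                                    ≡⟨ gauss-pascal₁ 0 (suc b) n ⟩
    gauss 1 (suc b) n + (z^ 2 ℕ.+ b · gauss 0 (2 ℕ.+ b)) n                 ≡⟨ cong (_+ (z^ 2 ℕ.+ b · gauss 0 (2 ℕ.+ b)) n) (gauss-pascal₂ zero b n) ⟩
    gauss 0 (suc b) n + (z^ 1 · gauss 1 b) n + (z^ 2 ℕ.+ b · gauss 0 (2 ℕ.+ b)) n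
      ≡⟨ cong₂ (λ s t → s + (z^ 1 · gauss 1 b) n + t) (gauss-zero-parts-same (2 ℕ.+ b) (suc b) n) (shift-shift 1 (suc b) _ n) ⟨
    gauss 0 (2 ℕ.+ b) n + (z^ 1 · gauss 1 b) n + (z^ 1 · z^ suc b · gauss 0 (2 ℕ.+ b)) n
      ≡⟨ ℤₚ.+-assoc (gauss 0 (2 ℕ.+ b) n) ((z^ 1 · gauss 1 b) n) _ ⟩
    gauss 0 (2 ℕ.+ b) n + ((z^ 1 · gauss 1 b) n + (z^ 1 · z^ suc b · gauss 0 (2 ℕ.+ b)) n)
      ≡⟨ cong (_+_ (gauss 0 (2 ℕ.+ b) n)) (shift-⊕ 1 (gauss 1 b) _ n) ⟨
    gauss 0 (2 ℕ.+ b) n + (z^ 1 · (gauss 1 b ⊕ z^ suc b · gauss 0 (2 ℕ.+ b))) n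
      ≡⟨ cong (_+_ (gauss 0 (2 ℕ.+ b) n)) (shift-cong 1 lower n) ⟩
    gauss 0 (2 ℕ.+ b) n + (z^ 1 · gauss 1 (suc b)) n                       ∎
    where
    lower : gauss 1 b ⊕ z^ suc b · gauss 0 (2 ℕ.+ b) ≗ gauss 1 (suc b)
    lower x = trans (cong (_+_ (gauss 1 b x)) (shift-cong (suc b) (gauss-zero-parts-same (2 ℕ.+ b) (suc b)) x))
                    (sym (gauss-pascal₁ 0 b x))
  gauss-pascal₂ (suc m) b n = begin
    gauss (2 ℕ.+ m) (suc b) n                                ≡⟨ gauss-pascal₁ (suc m) b n ⟩
    A + (z^ suc b · gauss (suc m) (suc b)) n                 ≡⟨ cong (_+_ A) (shift-cong (suc b) (gauss-pascal₂ m b) n) ⟩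
    A + (z^ suc b · (gauss m (suc b) ⊕ z^ suc m · gauss (suc m) b)) n
                                                             ≡⟨ cong (_+_ A) (shift-⊕ (suc b) _ _ n) ⟩
    A + (X + Y)                                              ≡⟨ swap A X Y ⟩
    A + Y + X                                                ≡⟨ cong (_+ X) (gauss-exchange m b n) ⟩
    B + W + X                                                ≡⟨ swap′ B W X ⟩
    B + X + W                                                ≡⟨ cong (_+ W) (gauss-pascal₁ m b n) ⟨
    gauss (suc m) (suc b) n + W                              ∎
    where
    A = gauss (2 ℕ.+ m) b n
    B = gauss (suc m) b n
    X = (z^ suc b · gauss m (suc b)) n
    Y = (z^ suc b · z^ suc m · gauss (suc m) b) n
    W = (z^ 2 ℕ.+ m · gauss (2 ℕ.+ m) b) n
    swap : ∀ a x y → a + (x + y) ≡ a + y + x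
    swap = solve-∀
    swap′ : ∀ a x y → a + x + y ≡ a + y + x
    swap′ = solve-∀

  gauss-exchange : ∀ m b →
    gauss (2 ℕ.+ m) b ⊕ z^ suc b · z^ suc m · gauss (suc m) b ≗ gauss (suc m) b ⊕ z^ 2 ℕ.+ m · gauss (2 ℕ.+ m) b
  gauss-exchange m zero n =
    cong₂ _+_ (trans (gauss-zero-bound (2 ℕ.+ m) n) (sym (gauss-zero-bound (suc m) n)))
              (trans (shift-shift 1 (suc m) _ n)
                     (shift-cong (2 ℕ.+ m) (λ x → trans (gauss-zero-bound (suc m) x) (sym (gauss-zero-bound (2 ℕ.+ m) x))) n))
  gauss-exchange m (suc b) n = begin
    gauss (2 ℕ.+ m) (suc b) n + (z^ 2 ℕ.+ b · z^ suc m · G) n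
      ≡⟨ cong (_+ (z^ 2 ℕ.+ b · z^ suc m · G) n) (gauss-pascal₂ (suc m) b n) ⟩
    G n + W + (z^ 2 ℕ.+ b · z^ suc m · G) n
      ≡⟨ cong (λ t → G n + W + t) reorder ⟩
    G n + W + (z^ 2 ℕ.+ m · z^ suc b · G) n
      ≡⟨ ℤₚ.+-assoc (G n) W _ ⟩
    G n + (W + (z^ 2 ℕ.+ m · z^ suc b · G) n)
      ≡⟨ cong (_+_ (G n)) (shift-⊕ (2 ℕ.+ m) (gauss (2 ℕ.+ m) b) (z^ suc b · G) n) ⟨
    G n + (z^ 2 ℕ.+ m · (gauss (2 ℕ.+ m) b ⊕ z^ suc b · G)) n
      ≡⟨ cong (_+_ (G n)) (shift-cong (2 ℕ.+ m) (sym ∘ gauss-pascal₁ (suc m) b) n) ⟩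
    G n + (z^ 2 ℕ.+ m · gauss (2 ℕ.+ m) (suc b)) n
      ∎
    where
    G = gauss (suc m) (suc b)
    W = (z^ 2 ℕ.+ m · gauss (2 ℕ.+ m) b) n
    exponents : ∀ b m → 2 ℕ.+ b ℕ.+ suc m ≡ 2 ℕ.+ m ℕ.+ suc b
    exponents = ℕ-Solver.solve-∀
    reorder : (z^ 2 ℕ.+ b · z^ suc m · G) n ≡ (z^ 2 ℕ.+ m · z^ suc b · G) n
    reorder = begin
      (z^ 2 ℕ.+ b · z^ suc m · G) n       ≡⟨ shift-shift (2 ℕ.+ b) (suc m) G n ⟩
      (z^ 2 ℕ.+ b ℕ.+ suc m · G) n        ≡⟨ cong (λ k → (z^ k · G) n) (exponents b m) ⟩
      (z^ 2 ℕ.+ m ℕ.+ suc b · G) n        ≡⟨ shift-shift (2 ℕ.+ m) (suc b) G n ⟨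
      (z^ 2 ℕ.+ m · z^ suc b · G) n       ∎

partitions : ℕ → Series
partitions m n = gauss m n n

partitions-zero : partitions 0 ≗ δ
partitions-zero n = gauss-zero-parts n n

partitions-unfold : ∀ m → partitions (suc m) ≗ partitions m ⊕ z^ suc m · partitions (suc m)
partitions-unfold m zero    = trans (gauss-zero-bound (suc m) 0) (sym (cong (_+ 0ℤ) (gauss-zero-bound m 0)))
partitions-unfold m (suc n) = begin
  gauss (suc m) (suc n) (suc n)                                              ≡⟨ gauss-pascal₂ m n (suc n) ⟩
  partitions m (suc n) + (z^ suc m · gauss (suc m) n) (suc n)                ≡⟨ cong (_+_ (partitions m (suc n))) (shift-cong-≤ (suc m) (suc n) stable) ⟩
  partitions m (suc n) + (z^ suc m · partitions (suc m)) (suc n)             ∎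
  where
  stable : ∀ x → suc m ℕ.+ x ≤ suc n → gauss (suc m) n x ≡ partitions (suc m) x
  stable x 1+m+x≤1+n = gauss-stable (suc m) n (ℕₚ.m+n≤o⇒n≤o m (ℕ.s≤s⁻¹ 1+m+x≤1+n))

Δ-partitions : ∀ m → Δ (suc m) (partitions (suc m)) ≗ partitions m
Δ-partitions m = unfold⇒Δ (suc m) (partitions m) (partitions (suc m)) (partitions-unfold m)

sumTo-unfold : ∀ f → sumTo f ≗ f ⊕ z^ 1 · sumTo f
sumTo-unfold f zero    = sym (ℤₚ.+-identityʳ (f 0))
sumTo-unfold f (suc n) = ℤₚ.+-comm (sumTo f n) (f (suc n))

Δ-sumTo : ∀ f → Δ 1 (sumTo f) ≗ f
Δ-sumTo f = unfold⇒Δ 1 f (sumTo f) (sumTo-unfold f)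

i+j≡k⇒i≡k-j : ∀ {x z : ℤ} y → x + y ≡ z → x ≡ z - y
i+j≡k⇒i≡k-j {x} y refl = sym (cancel x y)
  where
  cancel : ∀ a b → a + b - b ≡ a
  cancel = solve-∀

gauss-truncation : ∀ m N {n} → n ≤ suc N ℕ.+ suc N →
  gauss (suc m) N n ≡ partitions (suc m) n - (z^ suc N · sumTo (partitions m)) n
gauss-truncation m N {n} n≤2+2N = i+j≡k⇒i≡k-j ((z^ suc N · S) n) (trans (sym (invariant n)) unbounded)
  where
  S = sumTo (partitions m)
  T : ℕ → ℤ
  T b = gauss (suc m) b n + (z^ suc b · S) n

  step : ∀ b → n ≤ suc b ℕ.+ suc b → T (suc b) ≡ T b
  step b n≤2+2b = begin
    gauss (suc m) (suc b) n + (z^ 2 ℕ.+ b · S) n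
      ≡⟨ cong (_+ (z^ 2 ℕ.+ b · S) n) (gauss-pascal₁ m b n) ⟩
    G + (z^ suc b · gauss m (suc b)) n + (z^ 2 ℕ.+ b · S) n
      ≡⟨ ℤₚ.+-assoc G ((z^ suc b · gauss m (suc b)) n) _ ⟩
    G + ((z^ suc b · gauss m (suc b)) n + (z^ 2 ℕ.+ b · S) n)
      ≡⟨ cong (_+_ G) (cong₂ _+_ (shift-cong-≤ (suc b) n stable) (sym (trans (shift-comm (suc b) 1 S n) (shift-shift 1 (suc b) S n)))) ⟩
    G + ((z^ suc b · partitions m) n + (z^ suc b · z^ 1 · S) n)
      ≡⟨ cong (_+_ G) (shift-⊕ (suc b) (partitions m) (z^ 1 · S) n) ⟨
    G + (z^ suc b · (partitions m ⊕ z^ 1 · S)) n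
      ≡⟨ cong (_+_ G) (shift-cong (suc b) (sym ∘ sumTo-unfold (partitions m)) n) ⟩
    G + (z^ suc b · S) n ∎
    where
    G = gauss (suc m) b n
    stable : ∀ x → suc b ℕ.+ x ≤ n → gauss m (suc b) x ≡ partitions m x
    stable x 1+b+x≤n = gauss-stable m (suc b) (ℕₚ.+-cancelˡ-≤ (suc b) x (suc b) (ℕₚ.≤-trans 1+b+x≤n n≤2+2b))

  invariant : ∀ k → T (k ℕ.+ N) ≡ T N
  invariant zero    = refl
  invariant (suc k) = trans (step (k ℕ.+ N) (ℕₚ.≤-trans n≤2+2N (ℕₚ.+-mono-≤ N≤ N≤))) (invariant k)
    where
    N≤ : suc N ≤ suc (k ℕ.+ N)
    N≤ = s≤s (ℕₚ.m≤n+m N k)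

  unbounded : T (n ℕ.+ N) ≡ partitions (suc m) n
  unbounded = trans (cong₂ _+_ (gauss-stable (suc m) (n ℕ.+ N) (ℕₚ.m≤m+n n N)) (shift-< (suc (n ℕ.+ N)) S (s≤s (ℕₚ.m≤m+n n N))))
                    (ℤₚ.+-identityʳ _)

-- Even and odd parts

evenPart oddPart : Series → Series
evenPart f M = f (M ℕ.+ M)
oddPart  f M = f (suc (M ℕ.+ M))

evenPart-shift-even : ∀ a f → evenPart (z^ (a ℕ.+ a) · f) ≗ z^ a · evenPart f
evenPart-shift-even zero    f M       = refl
evenPart-shift-even (suc a) f zero    = refl
evenPart-shift-even (suc a) f (suc M) =
  trans (shift-reindex f (ℕₚ.+-suc a a) (ℕₚ.+-suc M M)) (evenPart-shift-even a f M)

oddPart-shift-even : ∀ a f → oddPart (z^ (a ℕ.+ a) · f) ≗ z^ a · oddPart f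
oddPart-shift-even zero    f M       = refl
oddPart-shift-even (suc a) f zero    = shift-reindex f (ℕₚ.+-suc a a) refl
oddPart-shift-even (suc a) f (suc M) =
  trans (shift-reindex f (ℕₚ.+-suc a a) (cong suc (ℕₚ.+-suc M M))) (oddPart-shift-even a f M)

evenPart-shift-odd : ∀ a f → evenPart (z^ suc (a ℕ.+ a) · f) ≗ z^ suc a · oddPart f
evenPart-shift-odd zero    f zero    = refl
evenPart-shift-odd zero    f (suc M) = cong f (ℕₚ.+-suc M M)
evenPart-shift-odd (suc a) f zero    = refl
evenPart-shift-odd (suc a) f (suc M) =
  trans (shift-reindex f (cong suc (ℕₚ.+-suc a a)) (ℕₚ.+-suc M M)) (evenPart-shift-odd a f M)

oddPart-shift-odd : ∀ a f → oddPart (z^ suc (a ℕ.+ a) · f) ≗ z^ a · evenPart f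
oddPart-shift-odd zero    f M       = refl
oddPart-shift-odd (suc a) f zero    = refl
oddPart-shift-odd (suc a) f (suc M) =
  trans (shift-reindex f (ℕₚ.+-suc a a) (ℕₚ.+-suc M M)) (oddPart-shift-odd a f M)

evenPart-Δ-even : ∀ a f → evenPart (Δ (a ℕ.+ a) f) ≗ Δ a (evenPart f)
evenPart-Δ-even a f M = cong (_-_ (evenPart f M)) (evenPart-shift-even a f M)

oddPart-Δ-even : ∀ a f → oddPart (Δ (a ℕ.+ a) f) ≗ Δ a (oddPart f)
oddPart-Δ-even a f M = cong (_-_ (oddPart f M)) (oddPart-shift-even a f M)

evenPart-Δ-odd : ∀ a f → evenPart (Δ (suc (a ℕ.+ a)) f) ≗ evenPart f ⊖ z^ suc a · oddPart f
evenPart-Δ-odd a f M = cong (_-_ (evenPart f M)) (evenPart-shift-odd a f M)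

oddPart-Δ-odd : ∀ a f → oddPart (Δ (suc (a ℕ.+ a)) f) ≗ oddPart f ⊖ z^ a · evenPart f
oddPart-Δ-odd a f M = cong (_-_ (oddPart f M)) (oddPart-shift-odd a f M)

-- Generating functions of partitions into at most four parts

invDen₁ invDen₂ invDen₃ : Series
invDen₁ = inv1-zpow 1
invDen₂ = invDen₁ ⊛ inv1-zpow 1
invDen₃ = invDen₂ ⊛ inv1-zpow 2

Δ-invDen₁ : Δ 1 invDen₁ ≗ δ
Δ-invDen₁ = unfold⇒Δ 1 δ invDen₁ (inv1-zpow-unfold 0)

Δ-invDen₂ : Δ 1 invDen₂ ≗ invDen₁
Δ-invDen₂ = Δ-⊛-inv1-zpow 0 invDen₁

Δ-invDen₃ : Δ 2 invDen₃ ≗ invDen₂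
Δ-invDen₃ = Δ-⊛-inv1-zpow 1 invDen₂

Δ-invDen : Δ 3 invDen ≗ invDen₃
Δ-invDen = Δ-⊛-inv1-zpow 2 invDen₃

partitions₁ : partitions 1 ≗ invDen₁
partitions₁ = Δ-injective 0 λ n → begin
  Δ 1 (partitions 1) n   ≡⟨ Δ-partitions 0 n ⟩
  partitions 0 n         ≡⟨ partitions-zero n ⟩
  δ n                    ≡⟨ Δ-invDen₁ n ⟨
  Δ 1 invDen₁ n          ∎

partitions₁-one : ∀ n → partitions 1 n ≡ 1ℤ
partitions₁-one n = trans (partitions₁ n) (inv1-zpow-one n)

Δ-invDen₃≗partitions₂ : Δ 1 invDen₃ ≗ partitions 2
Δ-invDen₃≗partitions₂ = Δ-injective 1 λ n → begin
  Δ 2 (Δ 1 invDen₃) n    ≡⟨ Δ-comm 2 1 invDen₃ n ⟩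
  Δ 1 (Δ 2 invDen₃) n    ≡⟨ Δ-cong 1 Δ-invDen₃ n ⟩
  Δ 1 invDen₂ n          ≡⟨ Δ-invDen₂ n ⟩
  invDen₁ n              ≡⟨ partitions₁ n ⟨
  partitions 1 n         ≡⟨ Δ-partitions 1 n ⟨
  Δ 2 (partitions 2) n   ∎

Δ-invDen≗partitions₃ : Δ 1 invDen ≗ partitions 3
Δ-invDen≗partitions₃ = Δ-injective 2 λ n → begin
  Δ 3 (Δ 1 invDen) n     ≡⟨ Δ-comm 3 1 invDen n ⟩
  Δ 1 (Δ 3 invDen) n     ≡⟨ Δ-cong 1 Δ-invDen n ⟩
  Δ 1 invDen₃ n          ≡⟨ Δ-invDen₃≗partitions₂ n ⟩
  partitions 2 n         ≡⟨ Δ-partitions 2 n ⟨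
  Δ 3 (partitions 3) n   ∎

sumTo-partitions₃ : sumTo (partitions 3) ≗ invDen
sumTo-partitions₃ = Δ-injective 0 λ n → trans (Δ-sumTo (partitions 3) n) (sym (Δ-invDen≗partitions₃ n))

evenPart-partitions₂ : evenPart (partitions 2) ≗ invDen₂
evenPart-partitions₂ = Δ-injective 0 λ M → begin
  Δ 1 (evenPart (partitions 2)) M    ≡⟨ evenPart-Δ-even 1 (partitions 2) M ⟨
  Δ 2 (partitions 2) (M ℕ.+ M)       ≡⟨ Δ-partitions 1 (M ℕ.+ M) ⟩
  partitions 1 (M ℕ.+ M)             ≡⟨ trans (partitions₁-one (M ℕ.+ M)) (sym (inv1-zpow-one M)) ⟩
  invDen₁ M                          ≡⟨ Δ-invDen₂ M ⟨
  Δ 1 invDen₂ M                      ∎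

oddPart-partitions₂ : oddPart (partitions 2) ≗ invDen₂
oddPart-partitions₂ = Δ-injective 0 λ M → begin
  Δ 1 (oddPart (partitions 2)) M     ≡⟨ oddPart-Δ-even 1 (partitions 2) M ⟨
  Δ 2 (partitions 2) (suc (M ℕ.+ M)) ≡⟨ Δ-partitions 1 (suc (M ℕ.+ M)) ⟩
  partitions 1 (suc (M ℕ.+ M))       ≡⟨ trans (partitions₁-one (suc (M ℕ.+ M))) (sym (inv1-zpow-one M)) ⟩
  invDen₁ M                          ≡⟨ Δ-invDen₂ M ⟨
  Δ 1 invDen₂ M                      ∎

Δ²-invDen-shifted-sum : ∀ k → Δ 3 (Δ 2 (invDen ⊕ z^ k · invDen)) ≗ invDen₂ ⊕ z^ k · invDen₂
Δ²-invDen-shifted-sum k n = begin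
  Δ 3 (Δ 2 (invDen ⊕ z^ k · invDen)) n    ≡⟨ Δ-comm 3 2 (invDen ⊕ z^ k · invDen) n ⟩
  Δ 2 (Δ 3 (invDen ⊕ z^ k · invDen)) n    ≡⟨ Δ-cong 2 (Δ-shifted-sum 3 k invDen Δ-invDen) n ⟩
  Δ 2 (invDen₃ ⊕ z^ k · invDen₃) n        ≡⟨ Δ-shifted-sum 2 k invDen₃ Δ-invDen₃ n ⟩
  invDen₂ n + (z^ k · invDen₂) n          ∎

evenPart-partitions₃-recurrence : evenPart (partitions 3) ⊖ z^ 2 · oddPart (partitions 3) ≗ invDen₂
evenPart-partitions₃-recurrence M =
  trans (sym (evenPart-Δ-odd 1 (partitions 3) M)) (trans (Δ-partitions 2 (M ℕ.+ M)) (evenPart-partitions₂ M))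

oddPart-partitions₃-recurrence : oddPart (partitions 3) ⊖ z^ 1 · evenPart (partitions 3) ≗ invDen₂
oddPart-partitions₃-recurrence M =
  trans (sym (oddPart-Δ-odd 1 (partitions 3) M)) (trans (Δ-partitions 2 (suc (M ℕ.+ M))) (oddPart-partitions₂ M))

evenPart-partitions₃ : evenPart (partitions 3) ≗ Δ 2 (invDen ⊕ z^ 2 · invDen)
evenPart-partitions₃ = Δ-injective 2 λ M →
  trans (Δ-coupled 2 1 {u = evenPart (partitions 3)} {v = oddPart (partitions 3)}
                   evenPart-partitions₃-recurrence oddPart-partitions₃-recurrence M)
        (sym (Δ²-invDen-shifted-sum 2 M))

oddPart-partitions₃ : oddPart (partitions 3) ≗ Δ 2 (invDen ⊕ z^ 1 · invDen)
oddPart-partitions₃ = Δ-injective 2 λ M →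
  trans (Δ-coupled 1 2 {u = oddPart (partitions 3)} {v = evenPart (partitions 3)}
                   oddPart-partitions₃-recurrence evenPart-partitions₃-recurrence M)
        (sym (Δ²-invDen-shifted-sum 1 M))

evenPart-partitions₄ : evenPart (partitions 4) ≗ invDen ⊕ z^ 2 · invDen
evenPart-partitions₄ = Δ-injective 1 λ M →
  trans (sym (evenPart-Δ-even 2 (partitions 4) M)) (trans (Δ-partitions 3 (M ℕ.+ M)) (evenPart-partitions₃ M))

oddPart-partitions₄ : oddPart (partitions 4) ≗ invDen ⊕ z^ 1 · invDen
oddPart-partitions₄ = Δ-injective 1 λ M →
  trans (sym (oddPart-Δ-even 2 (partitions 4) M)) (trans (Δ-partitions 3 (suc (M ℕ.+ M))) (oddPart-partitions₃ M))

gauss-even-diagonal : ∀ m a M →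
  gauss (suc m) (a ℕ.+ M) (M ℕ.+ M) ≡ (evenPart (partitions (suc m)) ⊖ z^ suc a · sumTo (partitions m)) M
gauss-even-diagonal m a M = begin
  gauss (suc m) (a ℕ.+ M) (M ℕ.+ M)                                 ≡⟨ gauss-truncation m (a ℕ.+ M) bound ⟩
  partitions (suc m) (M ℕ.+ M) - (z^ suc (a ℕ.+ M) · S) (M ℕ.+ M)   ≡⟨ cong (_-_ (partitions (suc m) (M ℕ.+ M))) rebase ⟩
  partitions (suc m) (M ℕ.+ M) - (z^ suc a · S) M                   ∎
  where
  S = sumTo (partitions m)
  bound : M ℕ.+ M ≤ suc (a ℕ.+ M) ℕ.+ suc (a ℕ.+ M)
  bound = ℕₚ.+-mono-≤ (ℕₚ.m≤n+m M (suc a)) (ℕₚ.m≤n+m M (suc a))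
  rebase : (z^ suc (a ℕ.+ M) · S) (M ℕ.+ M) ≡ (z^ suc a · S) M
  rebase = trans (shift-reindex S (ℕₚ.+-comm (suc a) M) refl) (shift-offset M (suc a) S M)

gauss-odd-diagonal : ∀ m a M →
  gauss (suc m) (suc a ℕ.+ M) (suc (M ℕ.+ M)) ≡ (oddPart (partitions (suc m)) ⊖ z^ suc a · sumTo (partitions m)) M
gauss-odd-diagonal m a M = begin
  gauss (suc m) (suc a ℕ.+ M) (suc (M ℕ.+ M))                                   ≡⟨ gauss-truncation m (suc a ℕ.+ M) bound ⟩
  partitions (suc m) (suc (M ℕ.+ M)) - (z^ 2 ℕ.+ a ℕ.+ M · S) (suc (M ℕ.+ M))   ≡⟨ cong (_-_ (partitions (suc m) (suc (M ℕ.+ M)))) rebase ⟩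
  partitions (suc m) (suc (M ℕ.+ M)) - (z^ suc a · S) M                         ∎
  where
  S = sumTo (partitions m)
  bound : suc (M ℕ.+ M) ≤ suc (suc a ℕ.+ M) ℕ.+ suc (suc a ℕ.+ M)
  bound = s≤s (ℕₚ.+-mono-≤ (ℕₚ.m≤n+m M (suc a)) (ℕₚ.m≤n+m M (2 ℕ.+ a)))
  rebase : (z^ 2 ℕ.+ a ℕ.+ M · S) (suc (M ℕ.+ M)) ≡ (z^ suc a · S) M
  rebase = trans (shift-reindex S (ℕₚ.+-comm (2 ℕ.+ a) M) (sym (ℕₚ.+-suc M M))) (shift-offset M (2 ℕ.+ a) S (suc M))

p-offset : ∀ x y m b → p (+ (x ℕ.+ y) - + x) m b ≡ cnt m b y
p-offset x y m b = cong (λ i → p i m b) (begin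
  + (x ℕ.+ y) - + x     ≡⟨ trans (ℤₚ.[+m]-[+n]≡m⊖n (x ℕ.+ y) x) (ℤₚ.⊖-≥ (ℕₚ.m≤m+n x y)) ⟩
  + (x ℕ.+ y ∸ x)        ≡⟨ cong +_ (ℕₚ.m+n∸m≡n x y) ⟩
  + y                    ∎)

p-negative : ∀ {x y} m b → x < y → p (+ x - + y) m b ≡ 0
p-negative {x} {y} m b x<y =
  trans (cong (λ i → p i m b) (trans (ℤₚ.[+m]-[+n]≡m⊖n x y) (ℤₚ.⊖-< x<y))) (negative (ℕₚ.m<n⇒0<n∸m x<y))
  where
  negative : ∀ {k} → 0 < k → p (- + k) m b ≡ 0
  negative (s≤s _) = refl

lhsEven-shift : ∀ a → lhsEven a ≗ z^ a · (λ M → gauss 4 (a ℕ.+ M) (M ℕ.+ M))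
lhsEven-shift a N with N ℕ.<? a
... | yes N<a = trans (cong +_ (p-negative 4 N (ℕₚ.*-monoʳ-< 2 N<a))) (sym (shift-< a _ N<a))
... | no N≮a with ℕₚ.m≤n⇒∃[o]m+o≡n (ℕₚ.≮⇒≥ N≮a)
...   | M , refl = begin
  + p (+ (2 ℕ.* (a ℕ.+ M)) - + (2 ℕ.* a)) 4 (a ℕ.+ M)             ≡⟨ cong (λ n → + p (+ n - + (2 ℕ.* a)) 4 (a ℕ.+ M)) (double a M) ⟩
  + p (+ (2 ℕ.* a ℕ.+ (M ℕ.+ M)) - + (2 ℕ.* a)) 4 (a ℕ.+ M)       ≡⟨ cong +_ (p-offset (2 ℕ.* a) (M ℕ.+ M) 4 (a ℕ.+ M)) ⟩
  gauss 4 (a ℕ.+ M) (M ℕ.+ M)                                      ≡⟨ shift-+ a _ M ⟨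
  (z^ a · (λ M → gauss 4 (a ℕ.+ M) (M ℕ.+ M))) (a ℕ.+ M)          ∎
  where
  double : ∀ a M → 2 ℕ.* (a ℕ.+ M) ≡ 2 ℕ.* a ℕ.+ (M ℕ.+ M)
  double = ℕ-Solver.solve-∀

lhsOdd-shift : ∀ a → lhsOdd a ≗ z^ suc a · (λ M → gauss 4 (suc a ℕ.+ M) (suc (M ℕ.+ M)))
lhsOdd-shift a N = trans (cong (λ i → + p i 4 N) (minus-one (+ (2 ℕ.* N)) (+ (2 ℕ.* a)))) (odd N)
  where
  minus-one : ∀ i j → i - j - 1ℤ ≡ i - (1ℤ + j)
  minus-one = solve-∀
  double : ∀ a M → 2 ℕ.* (suc a ℕ.+ M) ≡ suc (2 ℕ.* a) ℕ.+ suc (M ℕ.+ M)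
  double = ℕ-Solver.solve-∀
  odd : ∀ N → + p (+ (2 ℕ.* N) - + suc (2 ℕ.* a)) 4 N ≡ (z^ suc a · (λ M → gauss 4 (suc a ℕ.+ M) (suc (M ℕ.+ M)))) N
  odd N with N ℕ.<? suc a
  ... | yes N<1+a = trans (cong +_ (p-negative 4 N (s≤s (ℕₚ.*-monoʳ-≤ 2 (ℕ.s≤s⁻¹ N<1+a))))) (sym (shift-< (suc a) _ N<1+a))
  ... | no N≮1+a with ℕₚ.m≤n⇒∃[o]m+o≡n (ℕₚ.≮⇒≥ N≮1+a)
  ...   | M , refl = begin
    + p (+ (2 ℕ.* (suc a ℕ.+ M)) - + suc (2 ℕ.* a)) 4 (suc a ℕ.+ M)
      ≡⟨ cong (λ n → + p (+ n - + suc (2 ℕ.* a)) 4 (suc a ℕ.+ M)) (double a M) ⟩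
    + p (+ (suc (2 ℕ.* a) ℕ.+ suc (M ℕ.+ M)) - + suc (2 ℕ.* a)) 4 (suc a ℕ.+ M)
      ≡⟨ cong +_ (p-offset (suc (2 ℕ.* a)) (suc (M ℕ.+ M)) 4 (suc a ℕ.+ M)) ⟩
    gauss 4 (suc a ℕ.+ M) (suc (M ℕ.+ M))
      ≡⟨ shift-+ (suc a) _ M ⟨
    (z^ suc a · (λ M → gauss 4 (suc a ℕ.+ M) (suc (M ℕ.+ M)))) (suc a ℕ.+ M) ∎

odd-numerator : ∀ a (g : Series) →
  z^ suc a · (g ⊕ z^ 1 · g ⊖ z^ suc a · g) ≗ z^ a · (z^ 1 · g ⊕ z^ 2 · g ⊖ z^ a ℕ.+ 2 · g)
odd-numerator a g n = begin
  (z^ suc a · X) n                                      ≡⟨ shift-reindex X (ℕₚ.+-comm 1 a) refl ⟩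
  (z^ a ℕ.+ 1 · X) n                                    ≡⟨ shift-shift a 1 X n ⟨
  (z^ a · z^ 1 · X) n                                   ≡⟨ shift-cong a distribute n ⟩
  (z^ a · (z^ 1 · g ⊕ z^ 2 · g ⊖ z^ 2 ℕ.+ a · g)) n     ≡⟨ cong (λ k → (z^ a · (z^ 1 · g ⊕ z^ 2 · g ⊖ z^ k · g)) n) (ℕₚ.+-comm 2 a) ⟩
  (z^ a · (z^ 1 · g ⊕ z^ 2 · g ⊖ z^ a ℕ.+ 2 · g)) n     ∎
  where
  X = g ⊕ z^ 1 · g ⊖ z^ suc a · g
  distribute : z^ 1 · X ≗ z^ 1 · g ⊕ z^ 2 · g ⊖ z^ 2 ℕ.+ a · g
  distribute zero    = refl
  distribute (suc n) = refl

proposition1p5 : (a : ℕ) → ((N : ℕ) → lhsEven a N ≡ rhsEven a N) × ((N : ℕ) → lhsOdd a N ≡ rhsOdd a N)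
proposition1p5 a = even , odd
  where
  even : lhsEven a ≗ rhsEven a
  even N = begin
    lhsEven a N                                                  ≡⟨ lhsEven-shift a N ⟩
    (z^ a · (λ M → gauss 4 (a ℕ.+ M) (M ℕ.+ M))) N               ≡⟨ shift-cong a diagonal N ⟩
    (z^ a · (invDen ⊕ z^ 2 · invDen ⊖ z^ suc a · invDen)) N      ≡⟨ monomial-⊛ a 0 2 (suc a) invDen N ⟨
    rhsEven a N                                                  ∎
    where
    diagonal : (λ M → gauss 4 (a ℕ.+ M) (M ℕ.+ M)) ≗ invDen ⊕ z^ 2 · invDen ⊖ z^ suc a · invDen
    diagonal M = trans (gauss-even-diagonal 3 a M)
                       (cong₂ _-_ (evenPart-partitions₄ M) (shift-cong (suc a) sumTo-partitions₃ M))

  odd : lhsOdd a ≗ rhsOdd a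
  odd N = begin
    lhsOdd a N                                                               ≡⟨ lhsOdd-shift a N ⟩
    (z^ suc a · (λ M → gauss 4 (suc a ℕ.+ M) (suc (M ℕ.+ M)))) N             ≡⟨ shift-cong (suc a) diagonal N ⟩
    (z^ suc a · (invDen ⊕ z^ 1 · invDen ⊖ z^ suc a · invDen)) N              ≡⟨ odd-numerator a invDen N ⟩
    (z^ a · (z^ 1 · invDen ⊕ z^ 2 · invDen ⊖ z^ a ℕ.+ 2 · invDen)) N         ≡⟨ monomial-⊛ a 1 2 (a ℕ.+ 2) invDen N ⟨
    rhsOdd a N                                                               ∎
    where
    diagonal : (λ M → gauss 4 (suc a ℕ.+ M) (suc (M ℕ.+ M))) ≗ invDen ⊕ z^ 1 · invDen ⊖ z^ suc a · invDen
    diagonal M = trans (gauss-odd-diagonal 3 a M)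
                       (cong₂ _-_ (oddPart-partitions₄ M) (shift-cong (suc a) sumTo-partitions₃ M))
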